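{- Let $V=\mathbb{C}^n$ with basis $e_1,\dots,e_n$, and consider the basis $\{E_K\}$ of $\bigwedge^m(\bigwedge^kV)$ indexed by $k$-families $K$ on $[n]$ with $|K|=m$. Then $E_K$ is a highest weight vector (i.e. is annihilated by every strictly upper triangular $n\times n$ complex matrix) if and only if $K$ is a shifted $k$-family.
   Context: A $k$-family on $[n]$ is a collection of distinct $k$-subsets of $[n]$; it is shifted if down-closed in the componentwise order on $k$-sets ($\{x_1<\dots<x_k\}\le\{y_1<\dots<y_k\}$ iff $x_i\le y_i$ for all $i$). For $S=\{i_1<\dots<i_k\}$ let $e_S=e_{i_1}\wedge\dots\wedge e_{i_k}\in\bigwedge^kV$, and for $K=\{S_1,\dots,S_m\}$ (listed in a fixed order, e.g. lexicographic) let $E_K=e_{S_1}\wedge\dots\wedge e_{S_m}\in\bigwedge^m(\bigwedge^kV)$. The Lie algebra $\mathfrak{gl}_n(\mathbb{C})$ of all $n\times n$ complex matrices acts on $V$ by matrix multiplication and on exterior powers $\bigwedge^jU$ of a representation $U$ by the Leibniz rule $A(u_1\wedge\dots\wedge u_j)=\sum_{i=1}^j u_1\wedge\dots\wedge Au_i\wedge\dots\wedge u_j$. -}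

module Defs where

open import Level using (_⊔_)
open import Data.Nat using (ℕ; zero; suc; _≤_; _<_)
open import Data.Fin using (Fin; toℕ)
open import Data.List using (List; []; _∷_; map; foldr; _++_; concatMap; length; zipWith; allFin)
open import Data.List.Membership.Propositional using (_∈_)
open import Data.List.Relation.Binary.Pointwise using (Pointwise)
open import Data.List.Relation.Unary.All using (All)
open import Data.List.Relation.Unary.Linked using (Linked)
open import Data.Maybe using (Maybe; just; nothing)
open import Data.Bool using (Bool; true; false; if_then_else_; _xor_; not)
open import Data.Product using (_×_; _,_)
open import Relation.Binary.PropositionalEquality using (_≡_)
open import Algebra.Bundles using (CommutativeRing)

data Cmp : Set where
  lt eq gt : Cmp

cmpℕ : ℕ → ℕ → Cmp
cmpℕ zero    zero    = eq
cmpℕ zero    (suc _) = lt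
cmpℕ (suc _) zero    = gt
cmpℕ (suc m) (suc n) = cmpℕ m n

cmpFin : ∀ {n} → Fin n → Fin n → Cmp
cmpFin i j = cmpℕ (toℕ i) (toℕ j)

cmpLex : ∀ {a} {B : Set a} → (B → B → Cmp) → List B → List B → Cmp
cmpLex c []       []       = eq
cmpLex c []       (_ ∷ _)  = lt
cmpLex c (_ ∷ _)  []       = gt
cmpLex c (x ∷ xs) (y ∷ ys) with c x y
... | lt = lt
... | gt = gt
... | eq = cmpLex c xs ys

isEq : Cmp → Bool
isEq eq = true
isEq _  = false

choose : ∀ {a} {B : Set a} → List B → ℕ → List (List B)
choose xs       zero    = [] ∷ []
choose []       (suc j) = []
choose (x ∷ xs) (suc j) = map (x ∷_) (choose xs j) ++ choose xs (suc j)

tuples : ∀ {a} {B : Set a} → List B → ℕ → List (List B)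
tuples xs zero    = [] ∷ []
tuples xs (suc j) = concatMap (λ x → map (x ∷_) (tuples xs j)) xs

replaceEach : ∀ {a} {A : Set a} → (A → A) → List A → List (List A)
replaceEach f []       = []
replaceEach f (x ∷ xs) = (f x ∷ xs) ∷ map (x ∷_) (replaceEach f xs)

-- Exterior powers of a free module U with a totally ordered finite basis
-- (basis indices of type B, compared by cmp, enumerated by elems).
-- A vector of ⋀^j U is a coefficient function on lists of basis indices,
-- the basis of ⋀^j U being e_{b1} ∧ ... ∧ e_{bj} for b1 < ... < bj.

module Exterior {c ℓ} (R : CommutativeRing c ℓ)
                {a} {B : Set a} (cmp : B → B → Cmp) (elems : List B) where
  open CommutativeRing R

  Vect : Set (a ⊔ c)
  Vect = B → Carrier

  ExtVect : Set (a ⊔ c)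
  ExtVect = List B → Carrier

  sumR : List Carrier → Carrier
  sumR = foldr _+_ 0#

  prodR : List Carrier → Carrier
  prodR = foldr _*_ 1#

  sgn : Bool → Carrier
  sgn true  = - 1#
  sgn false = 1#

  unit : B → Vect
  unit b b' = if isEq (cmp b b') then 1# else 0#

  -- e_x ∧ e_{ys} for ys strictly increasing: nothing if it vanishes,
  -- otherwise the sorted list and the parity of the sign
  ins : B → List B → Maybe (List B × Bool)
  ins x []       = just (x ∷ [] , false)
  ins x (y ∷ ys) with cmp x y
  ... | lt = just (x ∷ y ∷ ys , false)
  ... | eq = nothing
  ... | gt with ins x ys
  ...   | nothing        = nothing
  ...   | just (zs , p)  = just (y ∷ zs , not p)

  normalize : List B → Maybe (List B × Bool)
  normalize []       = just ([] , false)
  normalize (x ∷ xs) with normalize xs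
  ... | nothing = nothing
  ... | just (ys , p) with ins x ys
  ...   | nothing       = nothing
  ...   | just (zs , q) = just (zs , p xor q)

  basisWedge : List B → ExtVect
  basisWedge bs T with normalize bs
  ... | nothing       = 0#
  ... | just (zs , p) = if isEq (cmpLex cmp zs T) then sgn p else 0#

  wedge : List Vect → ExtVect
  wedge us T = sumR (map (λ bs → prodR (zipWith (λ u b → u b) us bs) * basisWedge bs T)
                         (tuples elems (length us)))

  leibniz : (Vect → Vect) → List Vect → ExtVect
  leibniz f us T = sumR (map (λ vs → wedge vs T) (replaceEach f us))

  extAct : ℕ → (Vect → Vect) → ExtVect → ExtVect
  extAct j f x T = sumR (map (λ S → x S * leibniz f (map unit S) T) (choose elems j))

KSet : (n k : ℕ) → List (Fin n) → Set
KSet n k S = Linked (λ i j → toℕ i < toℕ j) S × length S ≡ k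

KFamily : (n k : ℕ) → List (List (Fin n)) → Set
KFamily n k K = All (KSet n k) K × Linked (λ S T → cmpLex cmpFin S T ≡ lt) K

_≤c_ : ∀ {n} → List (Fin n) → List (Fin n) → Set
S ≤c T = Pointwise (λ x y → toℕ x ≤ toℕ y) S T

Shifted : (n k : ℕ) → List (List (Fin n)) → Set
Shifted n k K = ∀ S T → S ∈ K → KSet n k T → T ≤c S → T ∈ K

module Setting {c ℓ} (R : CommutativeRing c ℓ) (n k : ℕ) where
  open CommutativeRing R

  Matrix : Set c
  Matrix = Fin n → Fin n → Carrier

  StrictlyUpper : Matrix → Set ℓ
  StrictlyUpper A = ∀ i j → toℕ j ≤ toℕ i → A i j ≈ 0#

  module V = Exterior R cmpFin (allFin n)
  module W = Exterior R (cmpLex cmpFin) (choose (allFin n) k)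

  actV : Matrix → V.Vect → V.Vect
  actV A v r = V.sumR (map (λ s → A r s * v s) (allFin n))

  actW : Matrix → W.Vect → W.Vect
  actW A = V.extAct k (actV A)

  E : List (List (Fin n)) → W.ExtVect
  E K = W.wedge (map W.unit K)

  actE : Matrix → List (List (Fin n)) → W.ExtVect
  actE A K = W.leibniz (actW A) (map W.unit K)

  HighestWeight : List (List (Fin n)) → Set (c ⊔ ℓ)
  HighestWeight K = ∀ (A : Matrix) → StrictlyUpper A → ∀ T → actE A K T ≈ 0#

module Submission where

-- By the Leibniz rule, A E_K is the sum over S ∈ K and k-sets U of (A e_S)_U E_{K[S ↦ U]}, where
-- K[S ↦ U] replaces S by U. A strictly upper triangular A lowers indices, so (A e_S)_U vanishes
-- unless U lies componentwise strictly below S; if K is shifted, such a U is already in K and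
-- E_{K[S ↦ U]} has a repeated factor. Conversely, if some T ≤ S ∈ K is missing from K, lowering S
-- towards T one entry at a time yields S ∈ K and S↓ ∉ K that differ in one entry x > y; for the
-- elementary matrix E_{yx}, the only term of E_{yx} E_K containing the basis vector E_{K[S ↦ S↓]}
-- comes from e_S ↦ e_{S↓}, so its coefficient is ±1 ≠ 0.

open import Algebra.Bundles using (CommutativeRing)
open import Data.Bool using (true; false)
open import Data.Empty using (⊥-elim)
open import Data.Fin using (Fin; toℕ; _<_)
open import Data.Fin.Properties using (toℕ-injective; <-trans; <-irrefl; ≤-refl; ≤-trans; ≤∧≢⇒<; <⇒≢)
  renaming (_≟_ to _≟ᶠ_)
open import Data.List using (List; []; _∷_; [_]; _++_; map; foldr; concatMap; zipWith; length; allFin)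
open import Data.List.Membership.Propositional using (_∈_; _∉_)
open import Data.List.Membership.Propositional.Properties
  using (∈-insert; ∈-++⁺ˡ; ∈-++⁺ʳ; ∈-++⁻; ∈-map⁺; ∈-map⁻; ∈-allFin; ∈-∃++)
open import Data.List.Properties using (map-++; map-∘; ++-assoc; ≡-dec; length-++; ∷-injective; ∷-injectiveʳ)
open import Data.List.Relation.Binary.Disjoint.Propositional using (Disjoint)
open import Data.List.Relation.Binary.Pointwise as Pointwise using ([]; _∷_)
open import Data.List.Relation.Unary.All as All using (All; []; _∷_)
open import Data.List.Relation.Unary.AllPairs as AllPairs using (AllPairs; []; _∷_)
import Data.List.Relation.Unary.AllPairs.Properties as AllPairsₚ
open import Data.List.Relation.Unary.Any using (here; there)
open import Data.List.Relation.Unary.Linked.Properties using (Linked⇒AllPairs; AllPairs⇒Linked)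
open import Data.List.Relation.Unary.Unique.Propositional using (Unique)
import Data.List.Relation.Unary.Unique.Propositional.Properties as Uniqueₚ
open import Data.Maybe using (just; nothing)
open import Data.Nat as ℕ using (ℕ; zero; suc; z≤n; s≤s)
import Data.Nat.Properties as ℕₚ
open import Data.Product using (_×_; _,_; proj₁; proj₂; ∃-syntax)
open import Data.Sum as Sum using (_⊎_; inj₁; inj₂)
open import Function using (id; _∘_; case_of_)
open import Function.Bundles using (_⇔_; mk⇔)
open import Relation.Binary.Definitions using (DecidableEquality; Transitive)
open import Relation.Binary.PropositionalEquality as ≡ using (_≡_; _≢_; refl)
import Relation.Binary.Reasoning.Setoid as ≈-Reasoning
open import Relation.Nullary using (¬_; yes; no)

open import Defs

record IsComparison {a} {B : Set a} (cmp : B → B → Cmp) : Set a where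
  field
    eq⇒≡     : ∀ x y → cmp x y ≡ eq → x ≡ y
    ≡⇒eq     : ∀ x → cmp x x ≡ eq
    lt⇒gt    : ∀ x y → cmp x y ≡ lt → cmp y x ≡ gt
    gt⇒lt    : ∀ x y → cmp x y ≡ gt → cmp y x ≡ lt
    lt-trans : ∀ x y z → cmp x y ≡ lt → cmp y z ≡ lt → cmp x z ≡ lt

cmpℕ-refl : ∀ m → cmpℕ m m ≡ eq
cmpℕ-refl zero    = refl
cmpℕ-refl (suc m) = cmpℕ-refl m

cmpℕ-eq⁻ : ∀ m n → cmpℕ m n ≡ eq → m ≡ n
cmpℕ-eq⁻ zero    zero    _ = refl
cmpℕ-eq⁻ (suc m) (suc n) e = ≡.cong suc (cmpℕ-eq⁻ m n e)

cmpℕ-lt⁻ : ∀ m n → cmpℕ m n ≡ lt → m ℕ.< n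
cmpℕ-lt⁻ zero    (suc n) _ = s≤s z≤n
cmpℕ-lt⁻ (suc m) (suc n) e = s≤s (cmpℕ-lt⁻ m n e)

cmpℕ-gt⁻ : ∀ m n → cmpℕ m n ≡ gt → n ℕ.< m
cmpℕ-gt⁻ (suc m) zero    _ = s≤s z≤n
cmpℕ-gt⁻ (suc m) (suc n) e = s≤s (cmpℕ-gt⁻ m n e)

cmpℕ-lt⁺ : ∀ {m n} → m ℕ.< n → cmpℕ m n ≡ lt
cmpℕ-lt⁺ {zero}  {suc n} _       = refl
cmpℕ-lt⁺ {suc m} {suc n} (s≤s p) = cmpℕ-lt⁺ p

cmpℕ-gt⁺ : ∀ {m n} → n ℕ.< m → cmpℕ m n ≡ gt
cmpℕ-gt⁺ {suc m} {zero}  _       = refl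
cmpℕ-gt⁺ {suc m} {suc n} (s≤s p) = cmpℕ-gt⁺ p

cmpFin-isComparison : ∀ {n} → IsComparison (cmpFin {n})
cmpFin-isComparison = record
  { eq⇒≡     = λ i j e → toℕ-injective (cmpℕ-eq⁻ (toℕ i) (toℕ j) e)
  ; ≡⇒eq     = λ i → cmpℕ-refl (toℕ i)
  ; lt⇒gt    = λ i j e → cmpℕ-gt⁺ (cmpℕ-lt⁻ (toℕ i) (toℕ j) e)
  ; gt⇒lt    = λ i j e → cmpℕ-lt⁺ (cmpℕ-gt⁻ (toℕ i) (toℕ j) e)
  ; lt-trans = λ i j l e f →
      cmpℕ-lt⁺ (ℕₚ.<-trans (cmpℕ-lt⁻ (toℕ i) (toℕ j) e) (cmpℕ-lt⁻ (toℕ j) (toℕ l) f))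
  }

module _ {a} {B : Set a} {c : B → B → Cmp} (isCmp : IsComparison c) where
  open IsComparison isCmp

  cmpLex-isComparison : IsComparison (cmpLex c)
  cmpLex-isComparison = record
    { eq⇒≡ = lex-eq⇒≡ ; ≡⇒eq = lex-≡⇒eq ; lt⇒gt = lex-lt⇒gt ; gt⇒lt = lex-gt⇒lt
    ; lt-trans = lex-lt-trans
    }
    where
    lex-≡⇒eq : ∀ xs → cmpLex c xs xs ≡ eq
    lex-≡⇒eq []       = refl
    lex-≡⇒eq (x ∷ xs) rewrite ≡⇒eq x = lex-≡⇒eq xs

    lex-eq⇒≡ : ∀ xs ys → cmpLex c xs ys ≡ eq → xs ≡ ys
    lex-eq⇒≡ []       []       _ = refl
    lex-eq⇒≡ (x ∷ xs) (y ∷ ys) e with c x y in exy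
    ... | eq = ≡.cong₂ _∷_ (eq⇒≡ x y exy) (lex-eq⇒≡ xs ys e)

    lex-lt⇒gt : ∀ xs ys → cmpLex c xs ys ≡ lt → cmpLex c ys xs ≡ gt
    lex-lt⇒gt []       (y ∷ ys) _ = refl
    lex-lt⇒gt (x ∷ xs) (y ∷ ys) e with c x y in exy
    ... | lt rewrite lt⇒gt x y exy = refl
    ... | eq with refl ← eq⇒≡ x y exy rewrite ≡⇒eq x = lex-lt⇒gt xs ys e

    lex-gt⇒lt : ∀ xs ys → cmpLex c xs ys ≡ gt → cmpLex c ys xs ≡ lt
    lex-gt⇒lt (x ∷ xs) []       _ = refl
    lex-gt⇒lt (x ∷ xs) (y ∷ ys) e with c x y in exy
    ... | gt rewrite gt⇒lt x y exy = refl
    ... | eq with refl ← eq⇒≡ x y exy rewrite ≡⇒eq x = lex-gt⇒lt xs ys e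

    lex-lt-trans : ∀ xs ys zs → cmpLex c xs ys ≡ lt → cmpLex c ys zs ≡ lt → cmpLex c xs zs ≡ lt
    lex-lt-trans []       (y ∷ ys) (z ∷ zs) _ _ = refl
    lex-lt-trans (x ∷ xs) (y ∷ ys) (z ∷ zs) e f with c x y in exy | c y z in eyz
    ... | lt | lt rewrite lt-trans x y z exy eyz = refl
    ... | lt | eq with refl ← eq⇒≡ y z eyz rewrite exy = refl
    ... | eq | lt with refl ← eq⇒≡ x y exy rewrite eyz = refl
    ... | eq | eq with refl ← eq⇒≡ x y exy | refl ← eq⇒≡ y z eyz rewrite ≡⇒eq x = lex-lt-trans xs ys zs e f

module ListSum {c ℓ} (R : CommutativeRing c ℓ) where
  open CommutativeRing R renaming (refl to ≈-refl)

  x≈0⇒x*y≈0 : ∀ {x y} → x ≈ 0# → x * y ≈ 0#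
  x≈0⇒x*y≈0 x≈0 = trans (*-cong x≈0 ≈-refl) (zeroˡ _)

  y≈0⇒x*y≈0 : ∀ {x y} → y ≈ 0# → x * y ≈ 0#
  y≈0⇒x*y≈0 y≈0 = trans (*-cong ≈-refl y≈0) (zeroʳ _)

  sumR : List Carrier → Carrier
  sumR = foldr _+_ 0#

  sumR-++ : ∀ xs ys → sumR (xs ++ ys) ≈ sumR xs + sumR ys
  sumR-++ []       ys = sym (+-identityˡ _)
  sumR-++ (x ∷ xs) ys = trans (+-cong ≈-refl (sumR-++ xs ys)) (sym (+-assoc _ _ _))

  module _ {a} {A : Set a} where
    sumR-cong : ∀ (xs : List A) {f g : A → Carrier} → (∀ x → x ∈ xs → f x ≈ g x) →
                sumR (map f xs) ≈ sumR (map g xs)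
    sumR-cong []       _   = ≈-refl
    sumR-cong (x ∷ xs) f≈g = +-cong (f≈g x (here refl)) (sumR-cong xs (λ y y∈ → f≈g y (there y∈)))

    sumR-zero : ∀ (xs : List A) {f : A → Carrier} → (∀ x → x ∈ xs → f x ≈ 0#) → sumR (map f xs) ≈ 0#
    sumR-zero []       _   = ≈-refl
    sumR-zero (x ∷ xs) f≈0 = trans (+-cong (f≈0 x (here refl)) (sumR-zero xs (λ y y∈ → f≈0 y (there y∈))))
                                   (+-identityˡ 0#)

    sumR-single : ∀ {xs : List A} {x} (f : A → Carrier) → Unique xs → x ∈ xs →
                  (∀ y → y ∈ xs → y ≢ x → f y ≈ 0#) → sumR (map f xs) ≈ f x
    sumR-single {y ∷ xs} f (y∉ ∷ _) (here refl) f≈0 =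
      trans (+-cong ≈-refl (sumR-zero xs (λ z z∈ → f≈0 z (there z∈) (λ { refl → All.lookup y∉ z∈ refl }))))
            (+-identityʳ _)
    sumR-single {y ∷ xs} f (y∉ ∷ u) (there x∈) f≈0 =
      trans (+-cong (f≈0 y (here refl) (λ { refl → All.lookup y∉ x∈ refl }))
                    (sumR-single f u x∈ (λ z z∈ → f≈0 z (there z∈))))
            (+-identityˡ _)

    sumR-*ˡ : ∀ (xs : List A) k (f : A → Carrier) → sumR (map (λ x → k * f x) xs) ≈ k * sumR (map f xs)
    sumR-*ˡ []       k f = sym (zeroʳ k)
    sumR-*ˡ (x ∷ xs) k f = trans (+-cong ≈-refl (sumR-*ˡ xs k f)) (sym (distribˡ k (f x) _))

  module _ {a b} {A : Set a} {B : Set b} where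
    sumR-map : ∀ (xs : List A) (g : A → B) (f : B → Carrier) →
               sumR (map f (map g xs)) ≡ sumR (map (f ∘ g) xs)
    sumR-map xs g f = ≡.cong sumR (≡.sym (map-∘ xs))

    sumR-concatMap : ∀ (xs : List A) (F : A → List B) (f : B → Carrier) →
                     sumR (map f (concatMap F xs)) ≈ sumR (map (λ x → sumR (map f (F x))) xs)
    sumR-concatMap []       F f = ≈-refl
    sumR-concatMap (x ∷ xs) F f = begin
      sumR (map f (F x ++ concatMap F xs))         ≡⟨ ≡.cong sumR (map-++ f (F x) _) ⟩
      sumR (map f (F x) ++ map f (concatMap F xs)) ≈⟨ sumR-++ (map f (F x)) _ ⟩
      sumR (map f (F x)) + sumR (map f (concatMap F xs)) ≈⟨ +-cong ≈-refl (sumR-concatMap xs F f) ⟩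
      sumR (map f (F x)) + sumR (map (λ x → sumR (map f (F x))) xs) ∎
      where open ≈-Reasoning setoid

module _ {a} {A : Set a} where
  unique-mid : ∀ xs {x : A} {ys} → Unique (xs ++ x ∷ ys) → x ∉ xs ++ ys
  unique-mid []       (x∉ ∷ _) x∈          = All.lookup x∉ x∈ refl
  unique-mid (y ∷ xs) (y∉ ∷ _) (here refl) = All.lookup y∉ (∈-insert xs) refl
  unique-mid (y ∷ xs) (_ ∷ u)  (there x∈)  = unique-mid xs u x∈

  unique-split : ∀ xs xs' {x : A} {ys ys'} → Unique (xs ++ x ∷ ys) →
                 xs ++ x ∷ ys ≡ xs' ++ x ∷ ys' → xs ≡ xs' × ys ≡ ys'
  unique-split []       []         _        e = refl , ∷-injectiveʳ e
  unique-split []       (y ∷ xs')  (x∉ ∷ _) e with refl , e' ← ∷-injective e =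
    ⊥-elim (All.lookup x∉ (≡.subst (_ ∈_) (≡.sym e') (∈-insert xs')) refl)
  unique-split (y ∷ xs) []         (y∉ ∷ _) e with refl , _ ← ∷-injective e =
    ⊥-elim (All.lookup y∉ (∈-insert xs) refl)
  unique-split (y ∷ xs) (y' ∷ xs') (_ ∷ u)  e with refl , e' ← ∷-injective e
                                              with refl , refl ← unique-split xs xs' u e' = refl , refl

  ∈-remove : ∀ xs {x y : A} {ys} → y ∈ xs ++ x ∷ ys → y ≢ x → y ∈ xs ++ ys
  ∈-remove xs p y≢x with ∈-++⁻ xs p
  ... | inj₁ q         = ∈-++⁺ˡ q
  ... | inj₂ (here q)  = ⊥-elim (y≢x q)
  ... | inj₂ (there q) = ∈-++⁺ʳ xs q

  ∈-add : ∀ xs {x y : A} {ys} → y ∈ xs ++ ys → y ∈ xs ++ x ∷ ys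
  ∈-add xs p with ∈-++⁻ xs p
  ... | inj₁ q = ∈-++⁺ˡ q
  ... | inj₂ q = ∈-++⁺ʳ xs (there q)

  unique-replace : ∀ xs {x y : A} {ys} → Unique (xs ++ x ∷ ys) → y ∉ xs ++ ys → Unique (xs ++ y ∷ ys)
  unique-replace []       (_ ∷ u)  y∉ = All.tabulate (λ z∈ y≡z → y∉ (≡.subst (_∈ _) (≡.sym y≡z) z∈)) ∷ u
  unique-replace (z ∷ xs) {y = y} {ys} (z∉ ∷ u) y∉ =
    All.tabulate (λ w∈ → z≢ (∈-++⁻ xs w∈)) ∷ unique-replace xs u (y∉ ∘ there)
    where
    z≢ : ∀ {w} → w ∈ xs ⊎ w ∈ y ∷ ys → z ≢ w
    z≢ (inj₁ p)               = All.lookup z∉ (∈-++⁺ˡ p)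
    z≢ (inj₂ (here refl)) z≡y = y∉ (here (≡.sym z≡y))
    z≢ (inj₂ (there p))       = All.lookup z∉ (∈-++⁺ʳ xs (there p))

module ExteriorProperties {c ℓ} (R : CommutativeRing c ℓ)
                          {a} {B : Set a} {cmp : B → B → Cmp} (isCmp : IsComparison cmp)
                          (elems : List B) (elems-unique : Unique elems) where
  open CommutativeRing R renaming (refl to ≈-refl)
  open ListSum R
  open Exterior R cmp elems hiding (sumR)
  open IsComparison isCmp

  Sorted : List B → Set a
  Sorted = AllPairs (λ x y → cmp x y ≡ lt)

  _≟_ : DecidableEquality B
  x ≟ y with cmp x y in e
  ... | eq = yes (eq⇒≡ x y e)
  ... | lt = no λ { refl → case ≡.trans (≡.sym e) (≡⇒eq x) of λ () }
  ... | gt = no λ { refl → case ≡.trans (≡.sym e) (≡⇒eq x) of λ () }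

  ins-∈⁻ : ∀ x ys {zs p z} → ins x ys ≡ just (zs , p) → z ∈ zs → z ≡ x ⊎ z ∈ ys
  ins-∈⁻ x []       refl (here refl) = inj₁ refl
  ins-∈⁻ x (y ∷ ys) e    z∈ with cmp x y
  ins-∈⁻ x (y ∷ ys) refl (here refl) | lt = inj₁ refl
  ins-∈⁻ x (y ∷ ys) refl (there z∈)  | lt = inj₂ z∈
  ... | gt with ins x ys in e'
  ins-∈⁻ x (y ∷ ys) refl (here refl) | gt | just _ = inj₂ (here refl)
  ins-∈⁻ x (y ∷ ys) refl (there z∈)  | gt | just _ = Sum.map₂ there (ins-∈⁻ x ys e' z∈)

  ins-∈-self : ∀ x ys {zs p} → ins x ys ≡ just (zs , p) → x ∈ zs
  ins-∈-self x []       refl = here refl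
  ins-∈-self x (y ∷ ys) e with cmp x y
  ins-∈-self x (y ∷ ys) refl | lt = here refl
  ... | gt with ins x ys in e'
  ins-∈-self x (y ∷ ys) refl | gt | just _ = there (ins-∈-self x ys e')

  ins-∈⁺ : ∀ x ys {zs p z} → ins x ys ≡ just (zs , p) → z ∈ ys → z ∈ zs
  ins-∈⁺ x (y ∷ ys) e z∈ with cmp x y
  ins-∈⁺ x (y ∷ ys) refl z∈ | lt = there z∈
  ... | gt with ins x ys in e'
  ins-∈⁺ x (y ∷ ys) refl (here refl) | gt | just _ = here refl
  ins-∈⁺ x (y ∷ ys) refl (there z∈)  | gt | just _ = there (ins-∈⁺ x ys e' z∈)

  ins-nothing⇒∈ : ∀ x ys → ins x ys ≡ nothing → x ∈ ys
  ins-nothing⇒∈ x (y ∷ ys) e with cmp x y in exy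
  ... | eq = here (eq⇒≡ x y exy)
  ... | gt with ins x ys in e'
  ... | nothing = there (ins-nothing⇒∈ x ys e')

  ins-sorted : ∀ x ys {zs p} → Sorted ys → ins x ys ≡ just (zs , p) → Sorted zs
  ins-sorted x []       _ refl = [] ∷ []
  ins-sorted x (y ∷ ys) s e with cmp x y in exy
  ins-sorted x (y ∷ ys) (y< ∷ s) refl | lt = (exy ∷ All.map (lt-trans x y _ exy) y<) ∷ y< ∷ s
  ... | gt with ins x ys in e'
  ins-sorted x (y ∷ ys) (y< ∷ s) refl | gt | just _ =
    All.tabulate (λ z∈ → y<z (ins-∈⁻ x ys e' z∈)) ∷ ins-sorted x ys s e'
    where
    y<z : ∀ {z} → z ≡ x ⊎ z ∈ ys → cmp y z ≡ lt
    y<z (inj₁ refl) = gt⇒lt x y exy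
    y<z (inj₂ z∈)   = All.lookup y< z∈

  ins-lt : ∀ x ys → All (λ y → cmp x y ≡ lt) ys → ins x ys ≡ just (x ∷ ys , false)
  ins-lt x []       _          = refl
  ins-lt x (y ∷ ys) (x<y ∷ _) rewrite x<y = refl

  ins-∈⇒nothing : ∀ x ys → Sorted ys → x ∈ ys → ins x ys ≡ nothing
  ins-∈⇒nothing x (y ∷ ys) (y< ∷ s) x∈ with cmp x y in exy | x∈
  ... | eq | _           = refl
  ... | lt | here refl   = case ≡.trans (≡.sym exy) (≡⇒eq x) of λ ()
  ... | lt | there x∈ys  = case ≡.trans (≡.sym exy) (lt⇒gt y x (All.lookup y< x∈ys)) of λ ()
  ... | gt | here refl   = case ≡.trans (≡.sym exy) (≡⇒eq x) of λ ()
  ... | gt | there x∈ys rewrite ins-∈⇒nothing x ys s x∈ys = refl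

  normalize-∈⁻ : ∀ bs {zs p z} → normalize bs ≡ just (zs , p) → z ∈ zs → z ∈ bs
  normalize-∈⁻ []       refl ()
  normalize-∈⁻ (x ∷ xs) e z∈ with normalize xs in e₁
  ... | just (ys , _) with ins x ys in e₂
  normalize-∈⁻ (x ∷ xs) refl z∈ | just (ys , _) | just _ with ins-∈⁻ x ys e₂ z∈
  ... | inj₁ refl = here refl
  ... | inj₂ z∈ys = there (normalize-∈⁻ xs e₁ z∈ys)

  normalize-∈⁺ : ∀ bs {zs p z} → normalize bs ≡ just (zs , p) → z ∈ bs → z ∈ zs
  normalize-∈⁺ (x ∷ xs) e z∈ with normalize xs in e₁
  ... | just (ys , _) with ins x ys in e₂
  normalize-∈⁺ (x ∷ xs) refl (here refl) | just (ys , _) | just _ = ins-∈-self x ys e₂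
  normalize-∈⁺ (x ∷ xs) refl (there z∈)  | just (ys , _) | just _ = ins-∈⁺ x ys e₂ (normalize-∈⁺ xs e₁ z∈)

  normalize-sorted : ∀ bs {zs p} → normalize bs ≡ just (zs , p) → Sorted zs
  normalize-sorted []       refl = []
  normalize-sorted (x ∷ xs) e with normalize xs in e₁
  ... | just (ys , _) with ins x ys in e₂
  normalize-sorted (x ∷ xs) refl | just (ys , _) | just _ = ins-sorted x ys (normalize-sorted xs e₁) e₂

  normalize-just⇒unique : ∀ bs {zs p} → normalize bs ≡ just (zs , p) → Unique bs
  normalize-just⇒unique []       _ = []
  normalize-just⇒unique (x ∷ xs) e with normalize xs in e₁
  ... | just (ys , _) with ins x ys in e₂
  normalize-just⇒unique (x ∷ xs) refl | just (ys , _) | just _ =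
    All.tabulate (λ { z∈ refl → case ≡.trans (≡.sym e₂) (ins-∈⇒nothing x ys (normalize-sorted xs e₁)
                                                                  (normalize-∈⁺ xs e₁ z∈)) of λ () })
    ∷ normalize-just⇒unique xs e₁

  normalize-nothing⇒¬unique : ∀ bs → normalize bs ≡ nothing → ¬ Unique bs
  normalize-nothing⇒¬unique (x ∷ xs) e u with normalize xs in e₁
  normalize-nothing⇒¬unique (x ∷ xs) e (_ ∷ u)  | nothing = normalize-nothing⇒¬unique xs e₁ u
  ... | just (ys , _) with ins x ys in e₂
  normalize-nothing⇒¬unique (x ∷ xs) e (x∉ ∷ _) | just (ys , _) | nothing =
    All.lookup x∉ (normalize-∈⁻ xs e₁ (ins-nothing⇒∈ x ys e₂)) refl

  normalize-sorted-id : ∀ bs → Sorted bs → normalize bs ≡ just (bs , false)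
  normalize-sorted-id []       _ = refl
  normalize-sorted-id (x ∷ xs) (x< ∷ s) rewrite normalize-sorted-id xs s | ins-lt x xs x< = refl

  basisWedge-zero : ∀ bs T → (∀ {zs p} → normalize bs ≡ just (zs , p) → zs ≢ T) → basisWedge bs T ≈ 0#
  basisWedge-zero bs T zs≢T with normalize bs in e
  ... | nothing = ≈-refl
  ... | just (zs , p) with cmpLex cmp zs T in e'
  ... | lt = ≈-refl
  ... | gt = ≈-refl
  ... | eq = ⊥-elim (zs≢T refl (IsComparison.eq⇒≡ (cmpLex-isComparison isCmp) zs T e'))

  basisWedge-¬unique : ∀ bs T → ¬ Unique bs → basisWedge bs T ≈ 0#
  basisWedge-¬unique bs T ¬unique = basisWedge-zero bs T λ e _ → ¬unique (normalize-just⇒unique bs e)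

  basisWedge-∉ʳ : ∀ {bs T z} → z ∈ bs → z ∉ T → basisWedge bs T ≈ 0#
  basisWedge-∉ʳ {bs} {T} z∈ z∉ = basisWedge-zero bs T λ { e refl → z∉ (normalize-∈⁺ bs e z∈) }

  basisWedge-∉ˡ : ∀ {bs T z} → z ∈ T → z ∉ bs → basisWedge bs T ≈ 0#
  basisWedge-∉ˡ {bs} {T} z∈ z∉ = basisWedge-zero bs T λ { e refl → z∉ (normalize-∈⁻ bs e z∈) }

  basisWedge-normal : ∀ bs {zs p} → normalize bs ≡ just (zs , p) → basisWedge bs zs ≡ sgn p
  basisWedge-normal bs {zs} e with normalize bs | e
  ... | just _ | refl rewrite IsComparison.≡⇒eq (cmpLex-isComparison isCmp) zs = refl

  unit-diag : ∀ b → unit b b ≡ 1#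
  unit-diag b rewrite ≡⇒eq b = refl

  unit-offdiag : ∀ b b' → b ≢ b' → unit b b' ≡ 0#
  unit-offdiag b b' b≢b' with cmp b b' in e
  ... | eq = ⊥-elim (b≢b' (eq⇒≡ b b' e))
  ... | lt = refl
  ... | gt = refl

  sumR-unitˡ : ∀ {b} → b ∈ elems → (h : B → Carrier) → sumR (map (λ x → unit b x * h x) elems) ≈ h b
  sumR-unitˡ {b} b∈ h =
    trans (sumR-single _ elems-unique b∈ λ y _ y≢b →
             x≈0⇒x*y≈0 (reflexive (unit-offdiag b y (y≢b ∘ ≡.sym))))
          (trans (*-cong (reflexive (unit-diag b)) ≈-refl) (*-identityˡ _))

  sumR-unitʳ : ∀ {b} → b ∈ elems → (h : B → Carrier) → sumR (map (λ x → h x * unit b x) elems) ≈ h b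
  sumR-unitʳ b∈ h = trans (sumR-cong elems (λ x _ → *-comm _ _)) (sumR-unitˡ b∈ h)

  prefixWedge : List B → List Vect → ExtVect
  prefixWedge pre us T =
    sumR (map (λ bs → prodR (zipWith (λ u b → u b) us bs) * basisWedge (pre ++ bs) T) (tuples elems (length us)))

  basisWedge-++-assoc : ∀ pre x bs T → basisWedge ((pre ++ [ x ]) ++ bs) T ≡ basisWedge (pre ++ x ∷ bs) T
  basisWedge-++-assoc pre x bs T = ≡.cong (λ l → basisWedge l T) (++-assoc pre [ x ] bs)

  prefixWedge-∷ : ∀ pre u us T →
                  prefixWedge pre (u ∷ us) T ≈ sumR (map (λ x → u x * prefixWedge (pre ++ [ x ]) us T) elems)
  prefixWedge-∷ pre u us T = begin
    prefixWedge pre (u ∷ us) T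
      ≈⟨ sumR-concatMap elems (λ x → map (x ∷_) ts) term ⟩
    sumR (map (λ x → sumR (map term (map (x ∷_) ts))) elems)
      ≈⟨ sumR-cong elems (λ x _ → begin
           sumR (map term (map (x ∷_) ts))          ≡⟨ sumR-map ts (x ∷_) term ⟩
           sumR (map (λ bs → term (x ∷ bs)) ts)     ≈⟨ sumR-cong ts (λ bs _ → reassoc x bs) ⟩
           sumR (map (λ bs → u x * term' x bs) ts) ≈⟨ sumR-*ˡ ts (u x) (term' x) ⟩
           u x * prefixWedge (pre ++ [ x ]) us T    ∎) ⟩
    sumR (map (λ x → u x * prefixWedge (pre ++ [ x ]) us T) elems) ∎
    where
    open ≈-Reasoning setoid
    ts : List (List B)
    ts = tuples elems (length us)
    term : List B → Carrier
    term bs = prodR (zipWith (λ u b → u b) (u ∷ us) bs) * basisWedge (pre ++ bs) T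
    term' : B → List B → Carrier
    term' x bs = prodR (zipWith (λ u b → u b) us bs) * basisWedge ((pre ++ [ x ]) ++ bs) T
    reassoc : ∀ x bs → term (x ∷ bs) ≈ u x * term' x bs
    reassoc x bs =
      trans (*-assoc _ _ _) (*-cong ≈-refl (*-cong ≈-refl (reflexive (≡.sym (basisWedge-++-assoc pre x bs T)))))

  prefixWedge-unit : ∀ pre {b} us T → b ∈ elems → prefixWedge pre (unit b ∷ us) T ≈ prefixWedge (pre ++ [ b ]) us T
  prefixWedge-unit pre us T b∈ =
    trans (prefixWedge-∷ pre _ us T) (sumR-unitˡ b∈ (λ x → prefixWedge (pre ++ [ x ]) us T))

  prefixWedge-units : ∀ pre ys T → All (_∈ elems) ys → prefixWedge pre (map unit ys) T ≈ basisWedge (pre ++ ys) T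
  prefixWedge-units pre []       T []         =
    trans (+-identityʳ _) (*-identityˡ _)
  prefixWedge-units pre (y ∷ ys) T (y∈ ∷ ys∈) =
    trans (prefixWedge-unit pre (map unit ys) T y∈)
          (trans (prefixWedge-units (pre ++ [ y ]) ys T ys∈) (reflexive (basisWedge-++-assoc pre y ys T)))

  prefixWedge-∷-units : ∀ pre u ys T → All (_∈ elems) ys →
                        prefixWedge pre (u ∷ map unit ys) T ≈ sumR (map (λ x → u x * basisWedge (pre ++ x ∷ ys) T) elems)
  prefixWedge-∷-units pre u ys T ys∈ =
    trans (prefixWedge-∷ pre u (map unit ys) T)
          (sumR-cong elems (λ x _ → *-cong ≈-refl
            (trans (prefixWedge-units (pre ++ [ x ]) ys T ys∈) (reflexive (basisWedge-++-assoc pre x ys T)))))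

  module _ (f : Vect → Vect) where
    leibnizTerm : List B → B → List B → List B → B → Carrier
    leibnizTerm pre s post T x = f (unit s) x * basisWedge (pre ++ x ∷ post) T

    leibnizExpansion : List B → List B → ExtVect
    leibnizExpansion pre []      T = 0#
    leibnizExpansion pre (s ∷ S) T =
      sumR (map (leibnizTerm pre s S T) elems) + leibnizExpansion (pre ++ [ s ]) S T

    leibnizExpansion-prefixed : ∀ pre S T → All (_∈ elems) S →
      sumR (map (λ vs → prefixWedge pre vs T) (replaceEach f (map unit S))) ≈ leibnizExpansion pre S T
    leibnizExpansion-prefixed pre []      T []         = ≈-refl
    leibnizExpansion-prefixed pre (s ∷ S) T (s∈ ∷ S∈) = +-cong (prefixWedge-∷-units pre (f (unit s)) S T S∈) (begin
      sumR (map (λ vs → prefixWedge pre vs T) (map (unit s ∷_) (replaceEach f (map unit S))))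
        ≡⟨ sumR-map (replaceEach f (map unit S)) (unit s ∷_) _ ⟩
      sumR (map (λ vs → prefixWedge pre (unit s ∷ vs) T) (replaceEach f (map unit S)))
        ≈⟨ sumR-cong (replaceEach f (map unit S)) (λ vs _ → prefixWedge-unit pre vs T s∈) ⟩
      sumR (map (λ vs → prefixWedge (pre ++ [ s ]) vs T) (replaceEach f (map unit S)))
        ≈⟨ leibnizExpansion-prefixed (pre ++ [ s ]) S T S∈ ⟩
      leibnizExpansion (pre ++ [ s ]) S T ∎)
      where open ≈-Reasoning setoid

    leibniz-units : ∀ S T → All (_∈ elems) S → leibniz f (map unit S) T ≈ leibnizExpansion [] S T
    leibniz-units = leibnizExpansion-prefixed []

    leibnizExpansion-zero : ∀ pre S T →
      (∀ pre' s post → pre' ++ s ∷ post ≡ pre ++ S → s ∈ S →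
         ∀ x → x ∈ elems → leibnizTerm pre' s post T x ≈ 0#) →
      leibnizExpansion pre S T ≈ 0#
    leibnizExpansion-zero pre []      T _      = ≈-refl
    leibnizExpansion-zero pre (s ∷ S) T term≈0 =
      trans (+-cong (sumR-zero elems (term≈0 pre s S refl (here refl)))
                    (leibnizExpansion-zero (pre ++ [ s ]) S T λ pre' s' post e s'∈ →
                       term≈0 pre' s' post (≡.trans e (++-assoc pre [ s ] S)) (there s'∈)))
            (+-identityˡ 0#)

    leibnizExpansion-single : ∀ {S} T → Unique S → ∀ pre s post x → pre ++ s ∷ post ≡ S → x ∈ elems →
      (∀ pre' s' post' → pre' ++ s' ∷ post' ≡ S → s' ≢ s →
         ∀ y → y ∈ elems → leibnizTerm pre' s' post' T y ≈ 0#) →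
      (∀ y → y ∈ elems → y ≢ x → leibnizTerm pre s post T y ≈ 0#) →
      leibnizExpansion [] S T ≈ leibnizTerm pre s post T x
    leibnizExpansion-single {S} T S-unique pre s post x refl x∈ others≈0 same≈0 =
      go [] S refl (∈-insert pre)
      where
      go : ∀ pre' S' → pre' ++ S' ≡ S → s ∈ S' → leibnizExpansion pre' S' T ≈ leibnizTerm pre s post T x
      go pre' (s' ∷ S') e s∈ with s' ≟ s
      ... | yes refl with refl , refl ← unique-split pre' pre (≡.subst Unique (≡.sym e) S-unique) e =
        trans (+-cong (sumR-single _ elems-unique x∈ same≈0)
                      (leibnizExpansion-zero (pre' ++ [ s ]) S' T λ pre'' s'' post'' e' s''∈ →
                         others≈0 pre'' s'' post'' (≡.trans e' (++-assoc pre' [ s ] S'))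
                                  λ { refl → unique-mid pre' S-unique (∈-++⁺ʳ pre' s''∈) }))
              (+-identityʳ _)
      go pre' (s' ∷ S') e (here refl)  | no s'≢s = ⊥-elim (s'≢s refl)
      go pre' (s' ∷ S') e (there s∈)   | no s'≢s =
        trans (+-cong (sumR-zero elems (others≈0 pre' s' S' e s'≢s))
                      (go (pre' ++ [ s' ]) S' (≡.trans (++-assoc pre' [ s' ] S') e) s∈))
              (+-identityˡ _)

module _ {a} {A : Set a} where
  ∈-choose-∷⁻ : ∀ {x : A} xs j {L} → L ∈ choose (x ∷ xs) (suc j) →
                (∃[ L' ] L' ∈ choose xs j × L ≡ x ∷ L') ⊎ L ∈ choose xs (suc j)
  ∈-choose-∷⁻ {x} xs j L∈ = Sum.map₁ (∈-map⁻ (x ∷_)) (∈-++⁻ (map (x ∷_) (choose xs j)) L∈)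

  choose-⊆ : ∀ (xs : List A) j {L} → L ∈ choose xs j → All (_∈ xs) L
  choose-⊆ xs       zero    (here refl) = []
  choose-⊆ (x ∷ xs) (suc j) L∈ with ∈-choose-∷⁻ xs j L∈
  ... | inj₁ (L' , L'∈ , refl) = here refl ∷ All.map there (choose-⊆ xs j L'∈)
  ... | inj₂ L∈'               = All.map there (choose-⊆ xs (suc j) L∈')

  choose-length : ∀ (xs : List A) j {L} → L ∈ choose xs j → length L ≡ j
  choose-length xs       zero    (here refl) = refl
  choose-length (x ∷ xs) (suc j) L∈ with ∈-choose-∷⁻ xs j L∈
  ... | inj₁ (L' , L'∈ , refl) = ≡.cong suc (choose-length xs j L'∈)
  ... | inj₂ L∈'               = choose-length xs (suc j) L∈'

  choose-allPairs : ∀ {r} {_~_ : A → A → Set r} (xs : List A) j {L} →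
                    AllPairs _~_ xs → L ∈ choose xs j → AllPairs _~_ L
  choose-allPairs xs       zero    _          (here refl) = []
  choose-allPairs (x ∷ xs) (suc j) (x~ ∷ xs~) L∈ with ∈-choose-∷⁻ xs j L∈
  ... | inj₁ (L' , L'∈ , refl) = All.map (All.lookup x~) (choose-⊆ xs j L'∈) ∷ choose-allPairs xs j xs~ L'∈
  ... | inj₂ L∈'               = choose-allPairs xs (suc j) xs~ L∈'

  choose-unique : ∀ (xs : List A) j → Unique xs → Unique (choose xs j)
  choose-unique xs       zero    _        = [] ∷ []
  choose-unique []       (suc j) _        = []
  choose-unique (x ∷ xs) (suc j) (x∉ ∷ u) =
    Uniqueₚ.++⁺ (Uniqueₚ.map⁺ ∷-injectiveʳ (choose-unique xs j u)) (choose-unique xs (suc j) u) disjoint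
    where
    disjoint : Disjoint (map (x ∷_) (choose xs j)) (choose xs (suc j))
    disjoint (p , q) with ∈-map⁻ (x ∷_) p
    ... | _ , _ , refl with x∈ ∷ _ ← choose-⊆ xs (suc j) q = All.lookup x∉ x∈ refl

  module _ {r} {_≺_ : A → A → Set r} (≺-trans : Transitive _≺_) (≺-irrefl : ∀ {x} → ¬ x ≺ x)
           (_≟_ : DecidableEquality A) where
    choose-complete : ∀ xs S → AllPairs _≺_ xs → AllPairs _≺_ S → All (_∈ xs) S → S ∈ choose xs (length S)
    choose-complete xs       []      _          _          _                = here refl
    choose-complete (x ∷ xs) (s ∷ S) (x≺ ∷ xs≺) (s≺ ∷ S≺) (s∈ ∷ S⊆) with s ≟ x | s∈
    ... | yes refl | _ =
      ∈-++⁺ˡ (∈-map⁺ (s ∷_) (choose-complete xs S xs≺ S≺ (All.zipWith drop-head (s≺ , S⊆))))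
      where
      drop-head : ∀ {y} → s ≺ y × y ∈ s ∷ xs → y ∈ xs
      drop-head (s≺s , here refl) = ⊥-elim (≺-irrefl s≺s)
      drop-head (_   , there y∈)  = y∈
    ... | no s≢x | here s≡x = ⊥-elim (s≢x s≡x)
    ... | no _   | there s∈xs =
      ∈-++⁺ʳ (map (x ∷_) (choose xs (length S)))
             (choose-complete xs (s ∷ S) xs≺ (s≺ ∷ S≺) (s∈xs ∷ All.zipWith drop-head (s≺ , S⊆)))
      where
      drop-head : ∀ {y} → s ≺ y × y ∈ x ∷ xs → y ∈ xs
      drop-head (s≺x , here refl) = ⊥-elim (≺-irrefl (≺-trans (All.lookup x≺ s∈xs) s≺x))
      drop-head (_   , there y∈)  = y∈

module _ {n : ℕ} where
  allFin-sorted : AllPairs _<_ (allFin n)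
  allFin-sorted = AllPairsₚ.tabulate⁺-< id

  sorted⇒unique : ∀ {S : List (Fin n)} → AllPairs _<_ S → Unique S
  sorted⇒unique = AllPairs.map <⇒≢

  KSet⇒∈choose : ∀ {k S} → KSet n k S → S ∈ choose (allFin n) k
  KSet⇒∈choose (S-linked , refl) =
    choose-complete <-trans (<-irrefl refl) _≟ᶠ_ (allFin n) _ allFin-sorted (Linked⇒AllPairs <-trans S-linked)
                    (All.tabulate λ {i} _ → ∈-allFin i)

  ∈choose⇒KSet : ∀ {k S} → S ∈ choose (allFin n) k → KSet n k S
  ∈choose⇒KSet {k} S∈ =
    AllPairs⇒Linked (choose-allPairs (allFin n) k allFin-sorted S∈) , choose-length (allFin n) k S∈

  <-sorted⇒cmpFin-sorted : ∀ {S : List (Fin n)} → AllPairs _<_ S → AllPairs (λ i j → cmpFin i j ≡ lt) S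
  <-sorted⇒cmpFin-sorted = AllPairs.map cmpℕ-lt⁺

module Lowering {c ℓ} (R : CommutativeRing c ℓ) (n : ℕ) where
  open Exterior R (cmpFin {n}) (allFin n) using (ins; normalize)
  open ExteriorProperties R cmpFin-isComparison (allFin n) (Uniqueₚ.allFin⁺ n) using (normalize-sorted-id)

  ins-≤c : ∀ i (S T : List (Fin n)) {S' p} → S ≤c T → All (i <_) T → ins i S ≡ just (S' , p) → S' ≤c (i ∷ T)
  ins-≤c i []      []      []          _           refl = ≤-refl ∷ []
  ins-≤c i (s ∷ S) (t ∷ T) (s≤t ∷ S≤T) (i<t ∷ i<T) e with cmpFin i s in eis
  ins-≤c i (s ∷ S) (t ∷ T) (s≤t ∷ S≤T) (i<t ∷ i<T) refl | lt = ≤-refl ∷ s≤t ∷ S≤T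
  ... | gt with ins i S in e'
  ins-≤c i (s ∷ S) (t ∷ T) (s≤t ∷ S≤T) (i<t ∷ i<T) refl | gt | just _ =
    ℕₚ.<⇒≤ (cmpℕ-gt⁻ (toℕ i) (toℕ s) eis)
    ∷ Pointwise.transitive ≤-trans (ins-≤c i S T S≤T i<T e') (ℕₚ.<⇒≤ i<t ∷ Pointwise.refl ≤-refl)

  normalize-lowered-≤c : ∀ pre {x y} ys {zs p} → AllPairs _<_ (pre ++ x ∷ ys) → y < x →
                         normalize (pre ++ y ∷ ys) ≡ just (zs , p) → zs ≤c (pre ++ x ∷ ys)
  normalize-lowered-≤c [] {x} {y} ys (x< ∷ ys-sorted) y<x e
    rewrite normalize-sorted-id ys (<-sorted⇒cmpFin-sorted ys-sorted) with ins y ys in e'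
  normalize-lowered-≤c [] {x} {y} ys (x< ∷ ys-sorted) y<x refl | just _ =
    Pointwise.transitive ≤-trans (ins-≤c y ys ys (Pointwise.refl ≤-refl) (All.map (<-trans y<x) x<) e')
                                 (ℕₚ.<⇒≤ y<x ∷ Pointwise.refl ≤-refl)
  normalize-lowered-≤c (a ∷ pre) {x} {y} ys (a< ∷ sorted) y<x e with normalize (pre ++ y ∷ ys) in e₁
  ... | just (zs' , _) with ins a zs' in e₂
  normalize-lowered-≤c (a ∷ pre) {x} {y} ys (a< ∷ sorted) y<x refl | just (zs' , _) | just _ =
    ins-≤c a zs' (pre ++ x ∷ ys) (normalize-lowered-≤c pre ys sorted y<x e₁) a< e₂

module _ {n : ℕ} where
  open import Data.List.Membership.DecPropositional (≡-dec (_≟ᶠ_ {n})) using (_∈?_)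

  entrySum : List (Fin n) → ℕ
  entrySum = foldr (λ i s → toℕ i ℕ.+ s) 0

  entrySum-lower : ∀ pre {x y} ys → y < x → entrySum (pre ++ y ∷ ys) ℕ.< entrySum (pre ++ x ∷ ys)
  entrySum-lower []        ys y<x = ℕₚ.+-monoˡ-< (entrySum ys) y<x
  entrySum-lower (a ∷ pre) ys y<x = ℕₚ.+-monoʳ-< (toℕ a) (entrySum-lower pre ys y<x)

  All-<-≤c : ∀ {i : Fin n} {S T : List (Fin n)} → All (i <_) S → S ≤c T → All (i <_) T
  All-<-≤c []          []          = []
  All-<-≤c (i<s ∷ i<S) (s≤t ∷ S≤T) = ℕₚ.<-≤-trans i<s s≤t ∷ All-<-≤c i<S S≤T

  record LowerStep (S T : List (Fin n)) : Set where
    constructor lowerStep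
    field
      pre ys  : List (Fin n)
      x y     : Fin n
      S≡      : S ≡ pre ++ x ∷ ys
      y<x     : y < x
      sorted  : AllPairs _<_ (pre ++ y ∷ ys)
      above-T : T ≤c (pre ++ y ∷ ys)

  lowerStep-toward : ∀ S T → AllPairs _<_ S → AllPairs _<_ T → T ≤c S → T ≢ S → LowerStep S T
  lowerStep-toward []      []      _          _          []          T≢S = ⊥-elim (T≢S refl)
  lowerStep-toward (s ∷ S) (t ∷ T) (s< ∷ S<) (t< ∷ T<) (t≤s ∷ T≤S) T≢S with t ≟ᶠ s
  ... | yes refl
    with lowerStep pre ys x y refl y<x sorted above ← lowerStep-toward S T S< T< T≤S (T≢S ∘ ≡.cong (t ∷_)) =
    lowerStep (t ∷ pre) ys x y refl y<x (All-<-≤c t< above ∷ sorted) (≤-refl ∷ above)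
  ... | no t≢s = lowerStep [] S s t refl t<s (All.map (<-trans t<s) s< ∷ S<) (≤-refl ∷ T≤S)
    where
    t<s : t < s
    t<s = ≤∧≢⇒< t≤s t≢s

  record ShiftViolation (K : List (List (Fin n))) : Set where
    field
      pre ys : List (Fin n)
      x y    : Fin n
      ∈K     : pre ++ x ∷ ys ∈ K
      ∉K     : pre ++ y ∷ ys ∉ K
      y<x    : y < x
      sorted : AllPairs _<_ (pre ++ y ∷ ys)

  -- Lower S towards T one entry at a time (entrySum decreases); since T ∉ K, some step leaves K.
  shiftViolation : ∀ {K S T} → T ∉ K → AllPairs _<_ T → S ∈ K → AllPairs _<_ S → T ≤c S → ShiftViolation K
  shiftViolation {K} {S} {T} T∉K T< = descend (suc (entrySum S)) S ℕₚ.≤-refl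
    where
    descend : ∀ fuel S → entrySum S ℕ.< fuel → S ∈ K → AllPairs _<_ S → T ≤c S → ShiftViolation K
    descend (suc fuel) S sum<fuel S∈K S< T≤S with ≡-dec _≟ᶠ_ T S
    ... | yes refl = ⊥-elim (T∉K S∈K)
    ... | no T≢S with lowerStep pre ys x y refl y<x sorted above ← lowerStep-toward S T S< T< T≤S T≢S
                 with pre ++ y ∷ ys ∈? K
    ...   | no ∉K  = record { pre = pre ; ys = ys ; x = x ; y = y ; ∈K = S∈K ; ∉K = ∉K ; y<x = y<x ; sorted = sorted }
    ...   | yes ∈K = descend fuel (pre ++ y ∷ ys)
                       (ℕₚ.<-≤-trans (entrySum-lower pre ys y<x) (ℕₚ.≤-pred sum<fuel)) ∈K sorted above

module _ {n k : ℕ} where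
  KSet⇒sorted : ∀ {S} → KSet n k S → AllPairs _<_ S
  KSet⇒sorted = Linked⇒AllPairs <-trans ∘ proj₁

  KSet-lower : ∀ pre {x y : Fin n} ys → KSet n k (pre ++ x ∷ ys) → AllPairs _<_ (pre ++ y ∷ ys) →
               KSet n k (pre ++ y ∷ ys)
  KSet-lower pre ys (_ , len) sorted =
    AllPairs⇒Linked sorted , ≡.trans (length-++ pre) (≡.trans (≡.sym (length-++ pre)) len)

  kFamily-unique : ∀ {K} → KFamily n k K → Unique K
  kFamily-unique (_ , lex-linked) =
    AllPairs.map (λ { {S} S<S refl → case ≡.trans (≡.sym S<S) (IsComparison.≡⇒eq lex S) of λ () })
                 (Linked⇒AllPairs (λ {S} {T} {U} → IsComparison.lt-trans lex S T U) lex-linked)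
    where
    lex : IsComparison (cmpLex (cmpFin {n}))
    lex = cmpLex-isComparison cmpFin-isComparison

module HighestWeightCriterion {c ℓ} (R : CommutativeRing c ℓ)
                              (1≉0 : ¬ CommutativeRing._≈_ R (CommutativeRing.1# R) (CommutativeRing.0# R))
                              (n k : ℕ) where
  open CommutativeRing R renaming (refl to ≈-refl)
  open Setting R n k
  open Lowering R n
  open ListSum R using (x≈0⇒x*y≈0; y≈0⇒x*y≈0)
  open import Data.List.Membership.DecPropositional (≡-dec (_≟ᶠ_ {n})) using (_∈?_)
  module VP = ExteriorProperties R cmpFin-isComparison (allFin n) (Uniqueₚ.allFin⁺ n)
  module WP = ExteriorProperties R (cmpLex-isComparison cmpFin-isComparison) (choose (allFin n) k)
                                 (choose-unique (allFin n) k (Uniqueₚ.allFin⁺ n))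

  sgn≉0 : ∀ b → ¬ W.sgn b ≈ 0#
  sgn≉0 false 1≈0  = 1≉0 1≈0
  sgn≉0 true  -1≈0 = 1≉0 (trans (sym (+-identityʳ 1#)) (trans (+-cong ≈-refl (sym -1≈0)) (-‿inverseʳ 1#)))

  actV-unit : ∀ A j i → actV A (V.unit j) i ≈ A i j
  actV-unit A j i = VP.sumR-unitʳ (∈-allFin j) (A i)

  actW-unit : ∀ A {S} U → S ∈ choose (allFin n) k → actW A (W.unit S) U ≈ VP.leibnizExpansion (actV A) [] S U
  actW-unit A {S} U S∈ =
    trans (WP.sumR-unitˡ S∈ (λ S' → V.leibniz (actV A) (map V.unit S') U))
          (VP.leibniz-units (actV A) S U (All.tabulate λ {i} _ → ∈-allFin i))

  actE-expansion : ∀ A {K} T → KFamily n k K → actE A K T ≈ WP.leibnizExpansion (actW A) [] K T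
  actE-expansion A {K} T (K-ksets , _) = WP.leibniz-units (actW A) K T (All.map KSet⇒∈choose K-ksets)

  -- A sends e_x to a combination of e_r with r < x, and re-sorting a lowered k-set keeps it below S.
  strictlyUpper-actW-unit : ∀ {A} → StrictlyUpper A → ∀ {S} U → KSet n k S → ¬ (U ≤c S × U ≢ S) →
                            actW A (W.unit S) U ≈ 0#
  strictlyUpper-actW-unit {A} A-upper {S} U S-kset ¬U<S =
    trans (actW-unit A U (KSet⇒∈choose S-kset)) (VP.leibnizExpansion-zero (actV A) [] S U term≈0)
    where
    S-sorted : AllPairs _<_ S
    S-sorted = KSet⇒sorted S-kset
    term≈0 : ∀ pre x post → pre ++ x ∷ post ≡ S → x ∈ S → ∀ r → r ∈ allFin n →
             VP.leibnizTerm (actV A) pre x post U r ≈ 0#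
    term≈0 pre x post refl _ r _ with toℕ x ℕ.≤? toℕ r
    ... | yes x≤r = x≈0⇒x*y≈0 (trans (actV-unit A x r) (A-upper r x x≤r))
    ... | no x≰r  = y≈0⇒x*y≈0 (VP.basisWedge-zero (pre ++ r ∷ post) U U≢zs)
      where
      r<x : r < x
      r<x = ℕₚ.≰⇒> x≰r
      x∉ : x ∉ pre ++ r ∷ post
      x∉ x∈ = unique-mid pre (sorted⇒unique S-sorted) (∈-remove pre x∈ λ x≡r → <-irrefl (≡.sym x≡r) r<x)
      U≢zs : ∀ {zs p} → V.normalize (pre ++ r ∷ post) ≡ just (zs , p) → zs ≢ U
      U≢zs e refl = ¬U<S (normalize-lowered-≤c pre post S-sorted r<x e ,
                          λ U≡S → x∉ (VP.normalize-∈⁻ _ e (≡.subst (x ∈_) (≡.sym U≡S) (∈-insert pre))))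

  shifted⇒highestWeight : ∀ {K} → KFamily n k K → Shifted n k K → HighestWeight K
  shifted⇒highestWeight {K} K-family shifted A A-upper T =
    trans (actE-expansion A T K-family) (WP.leibnizExpansion-zero (actW A) [] K T term≈0)
    where
    coefficient≈0 : ∀ {S} pre post U → S ∈ K → ¬ (U ≤c S × U ≢ S) →
                    WP.leibnizTerm (actW A) pre S post T U ≈ 0#
    coefficient≈0 pre post U S∈K ¬U<S =
      x≈0⇒x*y≈0 (strictlyUpper-actW-unit A-upper U (All.lookup (proj₁ K-family) S∈K) ¬U<S)
    term≈0 : ∀ pre S post → pre ++ S ∷ post ≡ K → S ∈ K → ∀ U → U ∈ choose (allFin n) k →
             WP.leibnizTerm (actW A) pre S post T U ≈ 0#
    term≈0 pre S post K≡ S∈K U U∈ with U ∈? K | ≡-dec _≟ᶠ_ U S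
    ... | no U∉K | _        =
      coefficient≈0 pre post U S∈K λ (U≤S , _) → U∉K (shifted S U S∈K (∈choose⇒KSet U∈) U≤S)
    ... | yes _  | yes refl = coefficient≈0 pre post U S∈K λ (_ , U≢S) → U≢S refl
    ... | yes U∈K | no U≢S  = y≈0⇒x*y≈0 (WP.basisWedge-¬unique (pre ++ U ∷ post) T repeated)
      where
      repeated : ¬ Unique (pre ++ U ∷ post)
      repeated u = unique-mid pre u (∈-remove pre (≡.subst (U ∈_) (≡.sym K≡) U∈K) U≢S)

  elementary : Fin n → Fin n → Matrix
  elementary y x i j = V.unit y i * V.unit x j

  elementary-offdiag : ∀ y x i j → i ≢ y ⊎ j ≢ x → elementary y x i j ≈ 0#
  elementary-offdiag y x i j (inj₁ i≢y) = x≈0⇒x*y≈0 (reflexive (VP.unit-offdiag y i (i≢y ∘ ≡.sym)))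
  elementary-offdiag y x i j (inj₂ j≢x) = y≈0⇒x*y≈0 (reflexive (VP.unit-offdiag x j (j≢x ∘ ≡.sym)))

  elementary-diag : ∀ y x → elementary y x y x ≈ 1#
  elementary-diag y x = trans (*-cong (reflexive (VP.unit-diag y)) (reflexive (VP.unit-diag x))) (*-identityˡ 1#)

  elementary-strictlyUpper : ∀ {y x} → y < x → StrictlyUpper (elementary y x)
  elementary-strictlyUpper {y} {x} y<x i j j≤i with i ≟ᶠ y | j ≟ᶠ x
  ... | no i≢y   | _        = elementary-offdiag y x i j (inj₁ i≢y)
  ... | yes _    | no j≢x   = elementary-offdiag y x i j (inj₂ j≢x)
  ... | yes refl | yes refl = ⊥-elim (ℕₚ.<⇒≱ y<x j≤i)

  actW-elementary-lowering : ∀ pre {x y} ys → KSet n k (pre ++ x ∷ ys) → AllPairs _<_ (pre ++ y ∷ ys) →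
                             actW (elementary y x) (W.unit (pre ++ x ∷ ys)) (pre ++ y ∷ ys) ≈ 1#
  actW-elementary-lowering pre {x} {y} ys S-kset lowered-sorted = begin
    actW Eyx (W.unit (pre ++ x ∷ ys)) (pre ++ y ∷ ys)
      ≈⟨ actW-unit Eyx _ (KSet⇒∈choose S-kset) ⟩
    VP.leibnizExpansion (actV Eyx) [] (pre ++ x ∷ ys) (pre ++ y ∷ ys)
      ≈⟨ VP.leibnizExpansion-single (actV Eyx) _ S-unique pre x ys y refl (∈-allFin y) other-entry other-row ⟩
    actV Eyx (V.unit x) y * V.basisWedge (pre ++ y ∷ ys) (pre ++ y ∷ ys)
      ≈⟨ *-cong (trans (actV-unit Eyx x y) (elementary-diag y x))
                (reflexive (VP.basisWedge-normal (pre ++ y ∷ ys)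
                  (VP.normalize-sorted-id (pre ++ y ∷ ys) (<-sorted⇒cmpFin-sorted lowered-sorted)))) ⟩
    1# * 1#
      ≈⟨ *-identityˡ 1# ⟩
    1# ∎
    where
    open ≈-Reasoning setoid
    Eyx : Matrix
    Eyx = elementary y x
    S-unique : Unique (pre ++ x ∷ ys)
    S-unique = sorted⇒unique (KSet⇒sorted S-kset)
    other-entry : ∀ pre' s post → pre' ++ s ∷ post ≡ pre ++ x ∷ ys → s ≢ x → ∀ r → r ∈ allFin n →
                  VP.leibnizTerm (actV Eyx) pre' s post (pre ++ y ∷ ys) r ≈ 0#
    other-entry _ s _ _ s≢x r _ =
      x≈0⇒x*y≈0 (trans (actV-unit Eyx s r) (elementary-offdiag y x r s (inj₂ s≢x)))
    other-row : ∀ r → r ∈ allFin n → r ≢ y → VP.leibnizTerm (actV Eyx) pre x ys (pre ++ y ∷ ys) r ≈ 0#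
    other-row r _ r≢y = x≈0⇒x*y≈0 (trans (actV-unit Eyx x r) (elementary-offdiag y x r x (inj₁ r≢y)))

  module LoweredMember (Kpre Kpost : List (List (Fin n))) (pre ys : List (Fin n)) {x y : Fin n}
                       (K-family : KFamily n k (Kpre ++ (pre ++ x ∷ ys) ∷ Kpost))
                       (S↓∉K : pre ++ y ∷ ys ∉ Kpre ++ (pre ++ x ∷ ys) ∷ Kpost)
                       (y<x : y < x) (S↓-sorted : AllPairs _<_ (pre ++ y ∷ ys)) where
    S S↓ : List (Fin n)
    S  = pre ++ x ∷ ys
    S↓ = pre ++ y ∷ ys

    K K↓ : List (List (Fin n))
    K  = Kpre ++ S ∷ Kpost
    K↓ = Kpre ++ S↓ ∷ Kpost

    K-unique : Unique K
    K-unique = kFamily-unique K-family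

    K↓-unique : Unique K↓
    K↓-unique = unique-replace Kpre K-unique (S↓∉K ∘ ∈-add Kpre)

    S∉K↓ : S ∉ K↓
    S∉K↓ S∈ =
      unique-mid Kpre K-unique (∈-remove Kpre S∈ λ S≡S↓ → S↓∉K (≡.subst (_∈ K) S≡S↓ (∈-insert Kpre)))

    S-kset : KSet n k S
    S-kset = All.lookup (proj₁ K-family) (∈-insert Kpre)

    -- e_{S↓} arises only from e_S, so the basis vector E_{K↓} occurs in E_{yx} E_K with coefficient ±1.
    actE-elementary : ∀ {Z p} → W.normalize K↓ ≡ just (Z , p) → actE (elementary y x) K Z ≈ W.sgn p
    actE-elementary {Z} {p} e = begin
      actE Eyx K Z
        ≈⟨ actE-expansion Eyx Z K-family ⟩
      WP.leibnizExpansion (actW Eyx) [] K Z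
        ≈⟨ WP.leibnizExpansion-single (actW Eyx) Z K-unique Kpre S Kpost S↓ refl
             (KSet⇒∈choose (KSet-lower pre ys S-kset S↓-sorted)) other-member other-subset ⟩
      actW Eyx (W.unit S) S↓ * W.basisWedge K↓ Z
        ≈⟨ *-cong (actW-elementary-lowering pre ys S-kset S↓-sorted) (reflexive (WP.basisWedge-normal K↓ e)) ⟩
      1# * W.sgn p
        ≈⟨ *-identityˡ _ ⟩
      W.sgn p ∎
      where
      open ≈-Reasoning setoid
      Eyx : Matrix
      Eyx = elementary y x
      other-member : ∀ pre' T post → pre' ++ T ∷ post ≡ K → T ≢ S → ∀ U → U ∈ choose (allFin n) k →
                     WP.leibnizTerm (actW Eyx) pre' T post Z U ≈ 0#
      other-member pre' T post K≡ T≢S U _ = y≈0⇒x*y≈0 (WP.basisWedge-∉ʳ S∈ S∉Z)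
        where
        S∈ : S ∈ pre' ++ U ∷ post
        S∈ = ∈-add pre' (∈-remove pre' (≡.subst (S ∈_) (≡.sym K≡) (∈-insert Kpre)) (T≢S ∘ ≡.sym))
        S∉Z : S ∉ Z
        S∉Z = S∉K↓ ∘ WP.normalize-∈⁻ K↓ e
      other-subset : ∀ U → U ∈ choose (allFin n) k → U ≢ S↓ → WP.leibnizTerm (actW Eyx) Kpre S Kpost Z U ≈ 0#
      other-subset U _ U≢S↓ =
        y≈0⇒x*y≈0 (WP.basisWedge-∉ˡ (WP.normalize-∈⁺ K↓ e (∈-insert Kpre)) S↓∉)
        where
        S↓∉ : S↓ ∉ Kpre ++ U ∷ Kpost
        S↓∉ S↓∈ = S↓∉K (∈-add Kpre (∈-remove Kpre S↓∈ (U≢S↓ ∘ ≡.sym)))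

    ¬highestWeight : ¬ HighestWeight K
    ¬highestWeight hw with W.normalize K↓ in e
    ... | nothing      = WP.normalize-nothing⇒¬unique K↓ e K↓-unique
    ... | just (Z , p) =
      sgn≉0 p (trans (sym (actE-elementary e)) (hw (elementary y x) (elementary-strictlyUpper y<x) Z))

  highestWeight⇒shifted : ∀ {K} → KFamily n k K → HighestWeight K → Shifted n k K
  highestWeight⇒shifted {K} K-family hw S T S∈K T-kset T≤S with T ∈? K
  ... | yes T∈K = T∈K
  ... | no T∉K
    with shiftViolation T∉K (KSet⇒sorted T-kset) S∈K (KSet⇒sorted (All.lookup (proj₁ K-family) S∈K)) T≤S
  ...   | record { pre = pre ; ys = ys ; ∈K = S₀∈K ; ∉K = S↓∉K ; y<x = y<x ; sorted = sorted }
        with Kpre , Kpost , refl ← ∈-∃++ S₀∈K =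
    ⊥-elim (LoweredMember.¬highestWeight Kpre Kpost pre ys K-family S↓∉K y<x sorted hw)

  highestWeight⇔shifted : ∀ {K} → KFamily n k K → HighestWeight K ⇔ Shifted n k K
  highestWeight⇔shifted K-family = mk⇔ (highestWeight⇒shifted K-family) (shifted⇒highestWeight K-family)

proposition5p10 : ∀ {c ℓ} (R : CommutativeRing c ℓ) → ¬ (CommutativeRing._≈_ R (CommutativeRing.1# R) (CommutativeRing.0# R)) → (n k m : ℕ) (K : List (List (Fin n))) → KFamily n k K → length K ≡ m → (Setting.HighestWeight R n k K ⇔ Shifted n k K)
proposition5p10 R 1≉0 n k _ K K-family _ = HighestWeightCriterion.highestWeight⇔shifted R 1≉0 n k K-family
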